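{- For every positive integer $e$ and every positive divisor $d$ of $e$, the star $S_{e+1}$ admits a $d$-graceful $\alpha$-labeling.
   Context: The star $S_{e+1}$ is the complete bipartite graph with one part consisting of a single vertex (the center) and the other part of $e$ vertices. For a graph $\Gamma$ of size $e$ and a divisor $d$ of $e$ with $e=d\cdot m$, a $d$-graceful labeling of $\Gamma$ is an injective function $f:V(\Gamma)\to\{0,1,\ldots,d(m+1)-1\}$ such that $\{|f(x)-f(y)| : [x,y]\in E(\Gamma)\}=\{1,2,\ldots,d(m+1)-1\}\setminus\{m+1,2(m+1),\ldots,(d-1)(m+1)\}$. If $\Gamma$ is bipartite with parts $X,Y$, a $d$-graceful $\alpha$-labeling is a $d$-graceful labeling $f$ such that $\max f(X)<\min f(Y)$ for a suitable ordering of the two parts. -}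

module Defs where

open import Data.Nat using (ℕ; zero; suc; _+_; _*_; _<_; _≤_; NonZero)
open import Data.Nat.Divisibility using (_∣_)
open import Data.Fin using (Fin; zero; suc)
open import Data.Product using (Σ; _×_; _,_; ∃)
open import Data.Sum using (_⊎_)
open import Relation.Binary.PropositionalEquality using (_≡_; _≢_)
open import Relation.Nullary using (¬_)
open import Function.Definitions using (Injective)
open import Function.Bundles using (_⇔_)

open import Data.Nat using (∣_-_∣) public

record Graph : Set₁ where
  field
    nV   : ℕ
    Adj  : Fin nV → Fin nV → Set
    sym  : ∀ {x y} → Adj x y → Adj y x
    irr  : ∀ {x} → ¬ Adj x x

open Graph public

data StarAdj (e : ℕ) : Fin (suc e) → Fin (suc e) → Set where
  c-l : (i : Fin e) → StarAdj e zero (suc i)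
  l-c : (i : Fin e) → StarAdj e (suc i) zero

starSym : ∀ {e} {x y : Fin (suc e)} → StarAdj e x y → StarAdj e y x
starSym (c-l i) = l-c i
starSym (l-c i) = c-l i

starIrr : ∀ {e} {x : Fin (suc e)} → ¬ StarAdj e x x
starIrr ()

Star : ℕ → Graph
Star e = record { nV = suc e ; Adj = StarAdj e ; sym = starSym ; irr = starIrr }

InCenter : ∀ {e} → Fin (suc e) → Set
InCenter x = x ≡ zero

InLeaves : ∀ {e} → Fin (suc e) → Set
InLeaves x = x ≢ zero

-- The target set of edge labels for a d-graceful labeling with e = d·m:
-- {1, …, d(m+1)-1} \ {m+1, 2(m+1), …, (d-1)(m+1)}.
TargetLabel : (d m k : ℕ) → Set
TargetLabel d m k =
  (1 ≤ k × suc k ≤ d * suc m) ×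
  ¬ (Σ ℕ λ j → (1 ≤ j × suc j ≤ d) × k ≡ j * suc m)

-- d-graceful labeling of a graph Γ of size e = d·m.
-- (Γ's size e is a parameter; the hypothesis that Γ has e edges is
-- taken with the statement.)
record DGraceful (Γ : Graph) (d m : ℕ) (f : Fin (nV Γ) → ℕ) : Set where
  field
    injective : Injective _≡_ _≡_ f
    range     : ∀ x → f x < d * suc m
    edgeLabels : ∀ k →
      (Σ (Fin (nV Γ)) λ x → Σ (Fin (nV Γ)) λ y → Adj Γ x y × k ≡ ∣ f x - f y ∣)
      ⇔ TargetLabel d m k

DGracefulAlpha : (Γ : Graph) (X Y : Fin (nV Γ) → Set) (d m : ℕ)
                 (f : Fin (nV Γ) → ℕ) → Set
DGracefulAlpha Γ X Y d m f =
  DGraceful Γ d m f ×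
  ((∀ x y → X x → Y y → f x < f y) ⊎ (∀ x y → Y x → X y → f x < f y))

module Submission where

-- Write e = d·m with m ≥ 1 (m = 0 contradicts e ≥ 1).  Put the
-- label 0 on the center of the star and the label
--     gap m i = i + ⌊i/m⌋ + 1
-- on the i-th leaf (0 ≤ i < d·m).  Writing i = q·m + r with r < m gives
-- gap m i = q·(m+1) + (r+1): the map gap m skips exactly the multiples of
-- m+1, so it enumerates the positive integers that are not multiples of
-- m+1 in increasing order, and on [0, d·m) it hits exactly the target set
-- {1,…,d(m+1)-1} ∖ {m+1, …, (d-1)(m+1)}.

open import Defs
open import Data.Nat using (ℕ; suc; _*_; _<_; _≤_)
open import Data.Fin using (Fin)
open import Data.Product using (Σ; _×_)
open import Relation.Binary.PropositionalEquality using (_≡_)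

open import Data.Nat using (zero; _+_; _/_; _%_; z≤n; s≤s; NonZero)
open import Data.Nat.Properties
open import Data.Nat.DivMod
open import Data.Nat.Divisibility using (n∣m*n)
open import Data.Fin using (zero; suc; toℕ; fromℕ<)
open import Data.Fin.Properties using (toℕ<n; toℕ-injective; toℕ-fromℕ<)
open import Data.Product using (_,_)
open import Data.Sum using (inj₁)
open import Data.Empty using (⊥-elim)
open import Relation.Binary.Definitions using (tri<; tri≈; tri>)
open import Relation.Binary.PropositionalEquality
  using (refl; trans; cong; cong₂; _≢_; module ≡-Reasoning)
  renaming (sym to ≡-sym)
open import Function.Base using (_∘_)
open import Function.Bundles using (_⇔_; mk⇔)
open import Function.Definitions using (Injective)
open import Function.Properties.Equivalence using () renaming (trans to ⇔-trans)

centred : ∀ {e} → (Fin e → ℕ) → Fin (suc e) → ℕ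
centred h zero    = 0
centred h (suc i) = h i

EdgeLabel : (Γ : Graph) → (Fin (nV Γ) → ℕ) → ℕ → Set
EdgeLabel Γ f k =
  Σ (Fin (nV Γ)) λ x → Σ (Fin (nV Γ)) λ y → Adj Γ x y × k ≡ ∣ f x - f y ∣

-- Every edge of a star joins the center to a leaf, so with center label 0
-- the edge labels are exactly the leaf labels.
centred-edgeLabel : ∀ {e} (h : Fin e → ℕ) k →
  EdgeLabel (Star e) (centred h) k ⇔ (Σ (Fin e) λ i → k ≡ h i)
centred-edgeLabel h k = mk⇔ to from
  where
  to : EdgeLabel (Star _) (centred h) k → Σ (Fin _) λ i → k ≡ h i
  to (_ , _ , c-l i , k≡) = i , k≡
  to (_ , _ , l-c i , k≡) = i , trans k≡ (∣-∣-identityʳ (h i))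

  from : (Σ (Fin _) λ i → k ≡ h i) → EdgeLabel (Star _) (centred h) k
  from (i , k≡) = zero , suc i , c-l i , k≡

centred-injective : ∀ {e} (h : Fin e → ℕ) →
  Injective _≡_ _≡_ h → (∀ i → 0 < h i) → Injective _≡_ _≡_ (centred h)
centred-injective h inj pos {zero}  {zero}  _  = refl
centred-injective h inj pos {zero}  {suc j} eq = ⊥-elim (<⇒≢ (pos j) eq)
centred-injective h inj pos {suc i} {zero}  eq = ⊥-elim (<⇒≢ (pos i) (≡-sym eq))
centred-injective h inj pos {suc i} {suc j} eq = cong suc (inj eq)

centred-dGracefulAlpha : ∀ {e} d m (h : Fin e → ℕ) →
  Injective _≡_ _≡_ h → (∀ i → 0 < h i) →
  0 < d * suc m → (∀ i → h i < d * suc m) →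
  (∀ k → (Σ (Fin e) λ i → k ≡ h i) ⇔ TargetLabel d m k) →
  DGracefulAlpha (Star e) InCenter InLeaves d m (centred h)
centred-dGracefulAlpha d m h inj pos 0<bound bounded image =
  record
    { injective  = centred-injective h inj pos
    ; range      = range
    ; edgeLabels = λ k → ⇔-trans (centred-edgeLabel h k) (image k)
    }
  , inj₁ centerBelowLeaves
  where
  range : ∀ x → centred h x < d * suc m
  range zero    = 0<bound
  range (suc i) = bounded i

  centerBelowLeaves : ∀ x y → InCenter x → InLeaves y → centred h x < centred h y
  centerBelowLeaves _ zero    refl y≢0 = ⊥-elim (y≢0 refl)
  centerBelowLeaves _ (suc j) refl _   = pos j

block-bound : ∀ {r q N d} → r < N → q < d → r + q * N < d * N
block-bound {r} {q} {N} r<N q<d =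
  ≤-trans (+-monoˡ-< (q * N) r<N) (*-monoˡ-≤ N q<d)

module _ (n : ℕ) .{{_ : NonZero n}} where

  -- The i-th positive integer (counting from 0) that is not a multiple of n+1.
  gap : ℕ → ℕ
  gap i = suc (i + i / n)

  gap-positive : ∀ i → 0 < gap i
  gap-positive i = s≤s z≤n

  gap-strictlyIncreasing : ∀ {i j} → i < j → gap i < gap j
  gap-strictlyIncreasing i<j = s≤s (+-mono-<-≤ i<j (/-monoˡ-≤ n (<⇒≤ i<j)))

  gap-injective : Injective _≡_ _≡_ gap
  gap-injective {i} {j} eq with <-cmp i j
  ... | tri< i<j _ _ = ⊥-elim (<⇒≢ (gap-strictlyIncreasing i<j) eq)
  ... | tri≈ _ i≡j _ = i≡j
  ... | tri> _ _ j<i = ⊥-elim (<⇒≢ (gap-strictlyIncreasing j<i) (≡-sym eq))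

  gap-block : ∀ q r → r < n → gap (r + q * n) ≡ suc r + q * suc n
  gap-block q r r<n = cong suc (begin
      r + q * n + (r + q * n) / n  ≡⟨ cong (r + q * n +_) quotient ⟩
      r + q * n + q                ≡⟨ +-assoc r (q * n) q ⟩
      r + (q * n + q)              ≡⟨ cong (r +_) (+-comm (q * n) q) ⟩
      r + (q + q * n)              ≡⟨ cong (r +_) (≡-sym (*-suc q n)) ⟩
      r + q * suc n                ∎)
    where
    open ≡-Reasoning
    quotient : (r + q * n) / n ≡ q
    quotient = begin
      (r + q * n) / n    ≡⟨ +-distrib-/-∣ʳ r (n∣m*n q) ⟩
      r / n + q * n / n  ≡⟨ cong₂ _+_ (m<n⇒m/n≡0 r<n) (m*n/n≡m q n) ⟩
      0 + q              ∎

  gap-divMod : ∀ i → gap i ≡ suc (i % n) + (i / n) * suc n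
  gap-divMod i = begin
    gap i                            ≡⟨ cong gap (m≡m%n+[m/n]*n i n) ⟩
    gap (i % n + (i / n) * n)        ≡⟨ gap-block (i / n) (i % n) (m%n<n i n) ⟩
    suc (i % n) + (i / n) * suc n    ∎
    where open ≡-Reasoning

  gap-bounded : ∀ d i → i < d * n → gap i < d * suc n
  gap-bounded d i i<dn rewrite gap-divMod i =
    block-bound (s≤s (m%n<n i n)) (m<n*o⇒m/o<n {i} {d} {n} i<dn)

  -- gap i leaves the remainder (i mod n) + 1 ≠ 0 modulo n+1.
  gap-notMultiple : ∀ i j → gap i ≢ j * suc n
  gap-notMultiple i j gap≡ = 0≢1+n (begin
    0                                       ≡⟨ ≡-sym (m*n%n≡0 j (suc n)) ⟩
    (j * suc n) % suc n                     ≡⟨ cong (_% suc n) (≡-sym gap≡) ⟩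
    gap i % suc n                           ≡⟨ cong (_% suc n) (gap-divMod i) ⟩
    (suc (i % n) + (i / n) * suc n) % suc n ≡⟨ [m+kn]%n≡m%n (suc (i % n)) (i / n) (suc n) ⟩
    suc (i % n) % suc n                     ≡⟨ m<n⇒m%n≡m (s≤s (m%n<n i n)) ⟩
    suc (i % n)                             ∎)
    where open ≡-Reasoning

  gap-target : ∀ d i → i < d * n → TargetLabel d n (gap i)
  gap-target d i i<dn =
    (gap-positive i , gap-bounded d i i<dn) ,
    λ { (j , _ , gap≡) → gap-notMultiple i j gap≡ }

  -- Conversely every target label is a value of gap on [0, d·n): a target
  -- label k has a nonzero remainder r+1 modulo n+1 (otherwise it would be a
  -- forbidden multiple), and then k = gap (r + ⌊k/(n+1)⌋·n).
  gap-onto : ∀ d k → TargetLabel d n k → Σ ℕ λ i → i < d * n × k ≡ gap i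
  gap-onto d k ((1≤k , k<bound) , notMultiple) = fromRemainder (k % suc n) refl
    where
    q : ℕ
    q = k / suc n

    q<d : q < d
    q<d = m<n*o⇒m/o<n {k} {d} {suc n} k<bound

    fromRemainder : ∀ s → k % suc n ≡ s → Σ ℕ λ i → i < d * n × k ≡ gap i
    fromRemainder zero k%≡0 = ⊥-elim (notMultiple (q , (1≤q , q<d) , k≡qN))
      where
      k≡qN : k ≡ q * suc n
      k≡qN = trans (m≡m%n+[m/n]*n k (suc n)) (cong (_+ q * suc n) k%≡0)

      1≤q : 1 ≤ q
      1≤q = n≢0⇒n>0 λ q≡0 → <⇒≢ 1≤k (≡-sym (trans k≡qN (cong (_* suc n) q≡0)))
    fromRemainder (suc r) k%≡ = r + q * n , block-bound r<n q<d , (begin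
      k                    ≡⟨ m≡m%n+[m/n]*n k (suc n) ⟩
      k % suc n + q * suc n ≡⟨ cong (_+ q * suc n) k%≡ ⟩
      suc r + q * suc n    ≡⟨ ≡-sym (gap-block q r r<n) ⟩
      gap (r + q * n)      ∎)
      where
      open ≡-Reasoning
      r<n : r < n
      r<n = ≤-pred (≤-trans (≤-reflexive (cong suc (≡-sym k%≡))) (m%n<n k (suc n)))

  gap-image : ∀ d k →
    (Σ (Fin (d * n)) λ i → k ≡ gap (toℕ i)) ⇔ TargetLabel d n k
  gap-image d k = mk⇔ to from
    where
    to : (Σ (Fin (d * n)) λ i → k ≡ gap (toℕ i)) → TargetLabel d n k
    to (i , refl) = gap-target d (toℕ i) (toℕ<n i)

    from : TargetLabel d n k → Σ (Fin (d * n)) λ i → k ≡ gap (toℕ i)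
    from t with gap-onto d k t
    ... | i , i<dn , k≡ = fromℕ< i<dn , trans k≡ (cong gap (≡-sym (toℕ-fromℕ< i<dn)))

theorem3p3 : (e d m : ℕ) → 1 ≤ e → e ≡ d * m →
    Σ (Fin (suc e) → ℕ) λ f →
    DGracefulAlpha (Star e) InCenter InLeaves d m f
theorem3p3 e d zero 1≤e e≡ = ⊥-elim (<⇒≢ 1≤e (≡-sym (trans e≡ (*-zeroʳ d))))
theorem3p3 .(d * suc m) d (suc m) 1≤e refl =
  centred leafLabel ,
  centred-dGracefulAlpha d (suc m) leafLabel
    (toℕ-injective ∘ gap-injective (suc m))
    (gap-positive (suc m) ∘ toℕ)
    (≤-trans 1≤e (*-monoʳ-≤ d (n≤1+n (suc m))))
    (λ i → gap-bounded (suc m) d (toℕ i) (toℕ<n i))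
    (gap-image (suc m) d)
  where
  leafLabel : Fin (d * suc m) → ℕ
  leafLabel = gap (suc m) ∘ toℕ
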